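{- The system $T=(\mathcal{L},\{r_0,r_1,r_2\})$ is garbage separating with respect to $D=\{[G]\in\mathcal{G}^{\oplus}(\mathcal{L})\mid \text{the underlying graph of }G\text{ is a tree and }G\text{ has exactly one root node}\}$, and confluent modulo garbage with respect to $E=\{[G]\in D\mid l_G(V_G)=\{\square\}\}$.
   Context: Label alphabet $\mathcal{L}=(\{\square,\triangle\},\{\square\})$. A graph is $G=(V,E,s,t,l,m,p)$ with finite $V,E$, total $s,t:E\to V$, partial node labelling into $\{\square,\triangle\}$, total edge labelling into $\{\square\}$, partial rootedness $p:V\to\{0,1\}$ ($1$: root). A TLRG has $l,p$ total; $\mathcal{G}^{\oplus}(\mathcal{L})$ is the set of isomorphism classes $[G]$ of TLRGs. Morphisms preserve sources, targets, edge labels, node labels and rootedness where defined in the domain. A rule $\langle L\leftarrow K\rightarrow R\rangle$: TLRGs $L,R$ and a graph $K$ that is a subgraph of both. Application to a TLRG $G$ via injective $g:L\to G$ satisfying the dangling condition (no edge outside $g(L)$ incident to $g(V_L\setminus V_K)$): delete images of $L\setminus K$; make $g_V(v)$ unlabelled / of undefined rootedness when $v\in V_K$ is so in $K$; add disjointly $R\setminus K$; give such $g_V(v)$ label $l_R(v)$ / rootedness $p_R(v)$. Rules (all edges labelled $\square$): $r_0$: $L$ = unrooted node 1 labelled $\square$ with an edge to rooted node 2 labelled $\square$; $K$ = node 1 unlabelled, undefined rootedness; $R$ = node 1 rooted labelled $\square$. $r_1$: as $r_0$ but node 1 in $L$ labelled $\triangle$. $r_2$: $L$ = rooted node 1 labelled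 $\square$ with edge to unrooted node 2 labelled $\square$; $K$ = nodes 1,2 unlabelled, undefined rootedness, no edges; $R$ = unrooted node 1 labelled $\triangle$ with edge to rooted node 2 labelled $\square$. A tree: non-empty, underlying undirected multigraph connected with no cycles (no loops or parallel edges), every node with at most one incoming edge. $T$ is garbage separating w.r.t. $D$ iff for all $G\Rightarrow_T H$: $[G]\in D\iff[H]\in D$. $T$ is confluent modulo garbage w.r.t. $E$ iff for all $G$ with $[G]\in E$ and all $H_1\Leftarrow^*G\Rightarrow^*H_2$, $H_1,H_2$ are joinable (there is $M$ with $H_1\Rightarrow^*M\Leftarrow^*H_2$). -}

module Defs where

open import Data.Nat using (ℕ; _<_)
open import Data.Fin using (Fin; _≟_)
open import Data.Bool using (Bool; true; false; if_then_else_)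
open import Data.List using (List; []; _∷_)
open import Data.List.Relation.Unary.Unique.Propositional using (Unique)
open import Data.Product using (Σ; ∃; ∃-syntax; _×_; _,_)
open import Data.Sum using (_⊎_)
open import Data.Unit using (⊤)
open import Data.Empty using (⊥)
open import Relation.Nullary using (¬_; does)
open import Relation.Binary.PropositionalEquality using (_≡_; _≢_)
open import Relation.Binary.Construct.Closure.ReflexiveTransitive using (Star)
open import Function.Bundles using (_⇔_)

data NLabel : Set where
  □ △ : NLabel

data ELabel : Set where
  e□ : ELabel

record TLRG : Set where
  field
    nV nE : ℕ
    src tgt : Fin nE → Fin nV
    lab  : Fin nV → NLabel
    elab : Fin nE → ELabel
    root : Fin nV → Bool
open TLRG public

-- "H is (isomorphic to) the graph obtained from G by keeping the nodes
-- satisfying keepV and the edges satisfying keepE, and giving each kept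
-- node x label newLab x and rootedness newRoot x."
-- φ, ψ are bijections from H onto the kept parts of G, commuting with
-- sources, targets and labels.

record Trace (G H : TLRG)
             (keepV : Fin (nV G) → Set) (keepE : Fin (nE G) → Set)
             (newLab : Fin (nV G) → NLabel) (newRoot : Fin (nV G) → Bool) : Set where
  field
    φ      : Fin (nV H) → Fin (nV G)
    φ-inj  : ∀ x y → φ x ≡ φ y → x ≡ y
    φ-keep : ∀ y → keepV (φ y)
    φ-onto : ∀ x → keepV x → ∃[ y ] φ y ≡ x
    ψ      : Fin (nE H) → Fin (nE G)
    ψ-inj  : ∀ d d' → ψ d ≡ ψ d' → d ≡ d'
    ψ-keep : ∀ d → keepE (ψ d)
    ψ-onto : ∀ d → keepE d → ∃[ d' ] ψ d' ≡ d
    src-c  : ∀ d → φ (src H d) ≡ src G (ψ d)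
    tgt-c  : ∀ d → φ (tgt H d) ≡ tgt G (ψ d)
    elab-c : ∀ d → elab H d ≡ elab G (ψ d)
    lab-c  : ∀ y → lab H y ≡ newLab (φ y)
    root-c : ∀ y → root H y ≡ newRoot (φ y)

_≅_ : TLRG → TLRG → Set
G ≅ H = Trace G H (λ _ → ⊤) (λ _ → ⊤) (lab G) (root G)

-- Injective match of a left-hand side  (1:lu,ru) --e--> (2:lv,rv)
-- into G: nodes u = g(1), v = g(2), edge e = g(edge).

record Match (G : TLRG) (lu : NLabel) (ru : Bool) (lv : NLabel) (rv : Bool) : Set where
  field
    u v   : Fin (nV G)
    e     : Fin (nE G)
    u≢v   : u ≢ v
    src-e : src G e ≡ u
    tgt-e : tgt G e ≡ v
    elab-e : elab G e ≡ e□
    lab-u : lab G u ≡ lu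
    root-u : root G u ≡ ru
    lab-v : lab G v ≡ lv
    root-v : root G v ≡ rv

Dangling : (G : TLRG) → Fin (nV G) → Fin (nE G) → Set
Dangling G v e = ∀ d → d ≢ e → src G d ≢ v × tgt G d ≢ v

upd : ∀ {n} {A : Set} → (Fin n → A) → Fin n → A → Fin n → A
upd f u a x = if does (x ≟ u) then a else f x

-- Rule applications.
-- r₀ / r₁: L = (1:□ or △, unrooted) --□--> (2:□, rooted); K = node 1 unlabelled,
--   undefined rootedness; R = node 1, □, rooted.
--   Effect: delete g(2) and g(edge); g(1) becomes □ and rooted.
-- r₂: L = (1:□, rooted) --□--> (2:□, unrooted); K = nodes 1,2 unlabelled,
--   undefined rootedness, no edges; R = (1:△, unrooted) --□--> (2:□, rooted).
--   Effect: delete g(edge), add a fresh □-edge g(1) → g(2)  (represented,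
--   up to isomorphism, by the kept edge position g(edge), which has the
--   same source and target and label); g(1) becomes △ unrooted,
--   g(2) becomes □ rooted.

Apply-r01 : NLabel → TLRG → TLRG → Set
Apply-r01 l1 G H =
  Σ (Match G l1 false □ true) λ m →
    let open Match m in
    Dangling G v e ×
    Trace G H (λ x → x ≢ v) (λ d → d ≢ e) (upd (lab G) u □) (upd (root G) u true)

Apply-r0 Apply-r1 Apply-r2 : TLRG → TLRG → Set
Apply-r0 = Apply-r01 □
Apply-r1 = Apply-r01 △
Apply-r2 G H =
  Σ (Match G □ true □ false) λ m →
    let open Match m in
    Trace G H (λ _ → ⊤) (λ _ → ⊤)
      (upd (upd (lab G) u △) v □) (upd (upd (root G) u false) v true)

_⇒_ : TLRG → TLRG → Set
G ⇒ H = Apply-r0 G H ⊎ Apply-r1 G H ⊎ Apply-r2 G H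

-- G ⇒* H : derivations of length ≥ 0, on isomorphism classes
-- (a length-0 derivation relates isomorphic graphs).
_⇒*_ : TLRG → TLRG → Set
_⇒*_ = Star (λ A B → A ≅ B ⊎ A ⇒ B)

UStep : (G : TLRG) → Fin (nV G) → Fin (nV G) → Fin (nE G) → Set
UStep G x y d = (src G d ≡ x × tgt G d ≡ y) ⊎ (tgt G d ≡ x × src G d ≡ y)

data Walk (G : TLRG) : Fin (nV G) → Fin (nV G) → Set where
  []  : ∀ {x} → Walk G x x
  _∷_ : ∀ {x y z} → (Σ (Fin (nE G)) (UStep G x y)) → Walk G y z → Walk G x z

walkEdges : ∀ {G x y} → Walk G x y → List (Fin (nE G))
walkEdges [] = []
walkEdges ((d , _) ∷ w) = d ∷ walkEdges w

walkStarts : ∀ {G x y} → Walk G x y → List (Fin (nV G))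
walkStarts [] = []
walkStarts {x = x} (_ ∷ w) = x ∷ walkStarts w

-- a cycle: closed walk of length ≥ 1 with pairwise distinct edges and
-- pairwise distinct nodes (loops and pairs of parallel edges are cycles)
IsCycle : ∀ {G x} → Walk G x x → Set
IsCycle [] = ⊥
IsCycle w@(_ ∷ _) = Unique (walkEdges w) × Unique (walkStarts w)

Connected : TLRG → Set
Connected G = ∀ x y → Walk G x y

Acyclic : TLRG → Set
Acyclic G = ∀ x (w : Walk G x x) → ¬ IsCycle w

AtMostOneIncoming : TLRG → Set
AtMostOneIncoming G = ∀ d d' → tgt G d ≡ tgt G d' → d ≡ d'

IsTree : TLRG → Set
IsTree G = 0 < nV G × Connected G × Acyclic G × AtMostOneIncoming G

ExactlyOneRoot : TLRG → Set
ExactlyOneRoot G = ∃[ r ] (root G r ≡ true × ∀ x → root G x ≡ true → x ≡ r)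

-- membership in D and E (both are isomorphism-closed, so membership of
-- the class [G] is membership of a representative G)
InD : TLRG → Set
InD G = IsTree G × ExactlyOneRoot G

LabelImage□ : TLRG → Set
LabelImage□ G = (∀ x → lab G x ≡ □) × (∃[ x ] lab G x ≡ □)

InE : TLRG → Set
InE G = InD G × LabelImage□ G

GarbageSeparating : Set
GarbageSeparating = ∀ G H → G ⇒ H → (InD G ⇔ InD H)

ConfluentModuloGarbage : Set
ConfluentModuloGarbage =
  ∀ G → InE G → ∀ H₁ H₂ → G ⇒* H₁ → G ⇒* H₂ → ∃[ M ] (H₁ ⇒* M × H₂ ⇒* M)

module Submission where

-- A trace embeds the result H of a step into G, so H
-- inherits acyclicity and the in-degree bound, and a graph has exactly one
-- root iff exactly one kept node is marked by the new rootedness.  Rule r₂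
-- only relabels, so the tree structure is preserved and reflected, and the
-- mark moves from u to v.  Rules r₀/r₁ delete a leaf v whose only edge comes
-- from u: contracting that edge retracts G onto H (connectivity), a cycle
-- of G cannot pass through v (acyclicity), and the mark moves from v to u.
--
-- Along derivations from E an invariant holds: the graph is in
-- D, its root is □, and every △-node has a directed path to the root.  From
-- any such graph the root can be pushed down by r₂ (bounded by the length of
-- a simple directed path) and then deleted by r₀/r₁ (decreasing the number
-- of nodes), until it is an isolated node; so every derivation from E can be
-- continued to the singleton graph, which joins any two of them.

open import Defs
open import Data.Nat using (ℕ; zero; suc; _≤_; _<_; z≤n; s≤s; _+_)
import Data.Nat.Properties as ℕP
open import Data.Fin using (Fin; zero; suc; _≟_; punchIn; punchOut)
import Data.Fin.Properties as FinP
open import Data.Bool using (Bool; true; false)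
open import Data.List using (List; []; _∷_; map; length; lookup)
open import Data.List.Relation.Unary.All as All using (All; []; _∷_)
open import Data.List.Relation.Unary.All.Properties using (¬Any⇒All¬)
open import Data.List.Relation.Unary.Any using (here; there; any?)
open import Data.List.Membership.Propositional using (_∈_)
open import Data.List.Membership.Propositional.Properties using (∈-lookup)
open import Data.List.Relation.Unary.AllPairs using ([]; _∷_)
open import Data.List.Relation.Unary.Unique.Propositional using (Unique)
import Data.List.Relation.Unary.Unique.Propositional.Properties as UniqueP
open import Data.Product using (Σ; ∃; ∃-syntax; _×_; _,_; proj₁; proj₂)
open import Data.Sum using (_⊎_; inj₁; inj₂)
open import Data.Unit using (⊤; tt)
open import Data.Empty using (⊥; ⊥-elim)
open import Relation.Nullary using (¬_; yes; no)
open import Relation.Binary.PropositionalEquality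
open import Relation.Binary.Construct.Closure.ReflexiveTransitive using (ε; _◅_)
open import Function.Bundles using (_⇔_; mk⇔; Equivalence)

upd-here : ∀ {n} {A : Set} (f : Fin n → A) u a → upd f u a u ≡ a
upd-here f u a with u ≟ u
... | yes _ = refl
... | no u≢u = ⊥-elim (u≢u refl)

upd-there : ∀ {n} {A : Set} (f : Fin n → A) {u} a {x} → x ≢ u → upd f u a x ≡ f x
upd-there f {u} a {x} x≢u with x ≟ u
... | yes x≡u = ⊥-elim (x≢u x≡u)
... | no _ = refl

upd₂-there : ∀ {n} {A : Set} (f : Fin n → A) {u v} a b {x} → x ≢ u → x ≢ v →
             upd (upd f u a) v b x ≡ f x
upd₂-there f a b x≢u x≢v = trans (upd-there (upd f _ a) b x≢v) (upd-there f a x≢u)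

nonEmpty : ∀ {n} → Fin n → 0 < n
nonEmpty zero = s≤s z≤n
nonEmpty (suc _) = s≤s z≤n

someNode : ∀ {n} → 0 < n → Fin n
someNode (s≤s _) = zero

true≢false : true ≢ false
true≢false ()

□≢△ : □ ≢ △
□≢△ ()

lookup-injective : ∀ {A : Set} {xs : List A} → Unique xs →
                   ∀ i j → lookup xs i ≡ lookup xs j → i ≡ j
lookup-injective (_ ∷ _) zero zero _ = refl
lookup-injective (x∉ ∷ _) zero (suc j) eq = ⊥-elim (All.lookup x∉ (∈-lookup j) eq)
lookup-injective (x∉ ∷ _) (suc i) zero eq = ⊥-elim (All.lookup x∉ (∈-lookup i) (sym eq))
lookup-injective (_ ∷ u) (suc i) (suc j) eq = cong suc (lookup-injective u i j eq)

unique-length : ∀ {n} {xs : List (Fin n)} → Unique xs → length xs ≤ n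
unique-length u = FinP.injective⇒≤ (λ {i} {j} → lookup-injective u i j)

_++ʷ_ : ∀ {G a b c} → Walk G a b → Walk G b c → Walk G a c
[] ++ʷ w' = w'
(s ∷ w) ++ʷ w' = s ∷ (w ++ʷ w')

flipStep : ∀ {G x y d} → UStep G x y d → UStep G y x d
flipStep (inj₁ (s , t)) = inj₂ (t , s)
flipStep (inj₂ (t , s)) = inj₁ (s , t)

reverseWalk : ∀ {G a b} → Walk G a b → Walk G b a
reverseWalk [] = []
reverseWalk {G} ((d , s) ∷ w) = reverseWalk w ++ʷ ((d , flipStep {G} s) ∷ [])

data DPath (G : TLRG) : Fin (nV G) → Fin (nV G) → Set where
  []   : ∀ {x} → DPath G x x
  step : ∀ {x z} (d : Fin (nE G)) → src G d ≡ x → DPath G (tgt G d) z → DPath G x z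

toWalk : ∀ {G a b} → DPath G a b → Walk G a b
toWalk [] = []
toWalk (step d d-from-x P) = (d , inj₁ (d-from-x , refl)) ∷ toWalk P

nodes : ∀ {G a b} → DPath G a b → List (Fin (nV G))
nodes P = walkStarts (toWalk P)

plen : ∀ {G a b} → DPath G a b → ℕ
plen P = length (nodes P)

nodes-are-sources : ∀ {G a b} (P : DPath G a b) → map (src G) (walkEdges (toWalk P)) ≡ nodes P
nodes-are-sources [] = refl
nodes-are-sources {G} (step d refl P) = cong (src G d ∷_) (nodes-are-sources P)

snoc : ∀ {G a b} (P : DPath G a b) d → src G d ≡ b → DPath G a (tgt G d)
snoc [] d d-from-b = step d d-from-b []
snoc (step d' p P) d d-from-b = step d' p (snoc P d d-from-b)

plen-snoc : ∀ {G a b} (P : DPath G a b) d (p : src G d ≡ b) → plen (snoc P d p) ≡ suc (plen P)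
plen-snoc [] d p = refl
plen-snoc (step d' p' P) d p = cong suc (plen-snoc P d p)

prefix : ∀ {G a b x} (P : DPath G a b) → x ∈ nodes P → Σ (DPath G a x) λ R → plen R < plen P
prefix (step d p P) (here refl) = [] , s≤s z≤n
prefix (step d p P) (there x∈P) with prefix P x∈P
... | R , R<P = step d p R , s≤s R<P

Loop : TLRG → ℕ → Set
Loop G k = ∃[ y ] Σ (DPath G y y) λ Q → 0 < plen Q × plen Q ≤ k

simple-or-loop : ∀ {G a b} (P : DPath G a b) → Unique (nodes P) ⊎ Loop G (plen P)
simple-or-loop [] = inj₁ []
simple-or-loop {a = a} (step d p P) with simple-or-loop P
... | inj₂ (y , Q , 0<Q , Q≤P) = inj₂ (y , Q , 0<Q , ℕP.m≤n⇒m≤1+n Q≤P)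
... | inj₁ P-simple with any? (a ≟_) (nodes P)
...   | yes a∈P = let (R , R<P) = prefix P a∈P in inj₂ (a , step d p R , s≤s z≤n , s≤s (ℕP.<⇒≤ R<P))
...   | no a∉P = inj₁ (¬Any⇒All¬ (nodes P) a∉P ∷ P-simple)

module AcyclicGraph {G : TLRG} (acyclic : Acyclic G) where

  -- A closed directed path through distinct nodes is a cycle: its edges are
  -- distinct because their sources are.
  no-simple-loop : ∀ {x} (Q : DPath G x x) → 0 < plen Q → Unique (nodes Q) → ⊥
  no-simple-loop [] () _
  no-simple-loop Q@(step _ _ _) _ simple =
    acyclic _ (toWalk Q) (UniqueP.map⁻ (subst Unique (sym (nodes-are-sources Q)) simple) , simple)

  -- There are no loops: a shortest loop would be a cycle.
  no-loop : ∀ k → ¬ Loop G k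
  no-loop k (_ , [] , () , _)
  no-loop zero (_ , step _ _ _ , _ , ())
  no-loop (suc k) (x , step d p P , _ , s≤s P≤k) with simple-or-loop P
  ... | inj₂ (y , Q , 0<Q , Q≤P) = no-loop k (y , Q , 0<Q , ℕP.≤-trans Q≤P P≤k)
  ... | inj₁ P-simple with any? (x ≟_) (nodes P)
  ...   | yes x∈P = let (R , R<P) = prefix P x∈P in no-loop k (x , step d p R , s≤s z≤n , ℕP.≤-trans R<P P≤k)
  ...   | no x∉P = no-simple-loop (step d p P) (s≤s z≤n) (¬Any⇒All¬ (nodes P) x∉P ∷ P-simple)

  nodes-unique : ∀ {a b} (P : DPath G a b) → Unique (nodes P)
  nodes-unique P with simple-or-loop P
  ... | inj₁ simple = simple
  ... | inj₂ loop = ⊥-elim (no-loop (plen P) loop)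

  plen-bound : ∀ {a b} (P : DPath G a b) → plen P ≤ nV G
  plen-bound P = unique-length (nodes-unique P)

  no-closed-path : ∀ {x} (Q : DPath G x x) → 0 < plen Q → ⊥
  no-closed-path Q 0<Q = no-loop (plen Q) (_ , Q , 0<Q , ℕP.≤-refl)

UniqueMark : ∀ {n} → (Fin n → Set) → (Fin n → Bool) → Set
UniqueMark K f = ∃[ x ] K x × f x ≡ true × ∀ y → K y → f y ≡ true → y ≡ x

module TraceFacts {G H kV kE nl nr} (tr : Trace G H kV kE nl nr) where
  open Trace tr

  mapStep : ∀ {a b d} → UStep H a b d → UStep G (φ a) (φ b) (ψ d)
  mapStep {d = d} (inj₁ (s , t)) = inj₁ (trans (sym (src-c d)) (cong φ s) , trans (sym (tgt-c d)) (cong φ t))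
  mapStep {d = d} (inj₂ (t , s)) = inj₂ (trans (sym (tgt-c d)) (cong φ t) , trans (sym (src-c d)) (cong φ s))

  mapWalk : ∀ {a b} → Walk H a b → Walk G (φ a) (φ b)
  mapWalk [] = []
  mapWalk ((d , s) ∷ w) = (ψ d , mapStep s) ∷ mapWalk w

  mapWalk-edges : ∀ {a b} (w : Walk H a b) → walkEdges (mapWalk w) ≡ map ψ (walkEdges w)
  mapWalk-edges [] = refl
  mapWalk-edges ((d , _) ∷ w) = cong (ψ d ∷_) (mapWalk-edges w)

  mapWalk-starts : ∀ {a b} (w : Walk H a b) → walkStarts (mapWalk w) ≡ map φ (walkStarts w)
  mapWalk-starts [] = refl
  mapWalk-starts {a} (_ ∷ w) = cong (φ a ∷_) (mapWalk-starts w)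

  acyclic⇒ : Acyclic G → Acyclic H
  acyclic⇒ acG x [] ()
  acyclic⇒ acG x w@(_ ∷ _) (uniqE , uniqS) =
    acG (φ x) (mapWalk w)
      ( subst Unique (sym (mapWalk-edges w)) (UniqueP.map⁺ (λ {d} {d'} → ψ-inj d d') uniqE)
      , subst Unique (sym (mapWalk-starts w)) (UniqueP.map⁺ (λ {y} {y'} → φ-inj y y') uniqS))

  atMostOneIncoming⇒ : AtMostOneIncoming G → AtMostOneIncoming H
  atMostOneIncoming⇒ inG d d' eq =
    ψ-inj d d' (inG (ψ d) (ψ d') (trans (sym (tgt-c d)) (trans (cong φ eq) (tgt-c d'))))

  Kept : Fin (nE G) → Set
  Kept d = ∃[ d' ] ψ d' ≡ d

  incoming-kept : AtMostOneIncoming H → ∀ d d' → Kept d → Kept d' → tgt G d ≡ tgt G d' → d ≡ d'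
  incoming-kept inH _ _ (d₁ , refl) (d₁' , refl) eq =
    cong ψ (inH d₁ d₁' (φ-inj _ _ (trans (tgt-c d₁) (trans eq (sym (tgt-c d₁'))))))

  liftWalk : ∀ {a b} (w : Walk G a b) → All Kept (walkEdges w) → ∀ {a' b'} → φ a' ≡ a → φ b' ≡ b →
             Σ (Walk H a' b') λ w' → map ψ (walkEdges w') ≡ walkEdges w × map φ (walkStarts w') ≡ walkStarts w
  liftWalk [] [] {a'} {b'} φa' φb' with φ-inj a' b' (trans φa' (sym φb'))
  ... | refl = [] , refl , refl
  liftWalk ((_ , inj₁ (refl , refl)) ∷ w) ((d' , refl) ∷ kept) φa' φb'
    with liftWalk w kept (tgt-c d') φb'
  ... | w' , edges≡ , starts≡ =
    (d' , inj₁ (φ-inj _ _ (trans (src-c d') (sym φa')) , refl)) ∷ w' , cong (ψ d' ∷_) edges≡ , cong₂ _∷_ φa' starts≡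
  liftWalk ((_ , inj₂ (refl , refl)) ∷ w) ((d' , refl) ∷ kept) φa' φb'
    with liftWalk w kept (src-c d') φb'
  ... | w' , edges≡ , starts≡ =
    (d' , inj₂ (φ-inj _ _ (trans (tgt-c d') (sym φa')) , refl)) ∷ w' , cong (ψ d' ∷_) edges≡ , cong₂ _∷_ φa' starts≡

  -- Hence, if H is acyclic, G has no cycle through kept edges at a node of H:
  -- it would lift to a cycle of H.
  liftCycle : Acyclic H → ∀ {x} (w : Walk G x x) → All Kept (walkEdges w) → ∀ {x'} → φ x' ≡ x → ¬ IsCycle w
  liftCycle acH [] _ _ ()
  liftCycle acH w@(_ ∷ _) kept φx' (uniqE , uniqS) with liftWalk w kept φx' φx'
  ... | [] , () , _
  ... | w'@(_ ∷ _) , edges≡ , starts≡ =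
    acH _ w' (UniqueP.map⁻ (subst Unique (sym edges≡) uniqE) , UniqueP.map⁻ (subst Unique (sym starts≡) uniqS))

  liftPath : ∀ {a b} (P : DPath G a b) → All Kept (walkEdges (toWalk P)) →
             ∀ {a' b'} → φ a' ≡ a → φ b' ≡ b → DPath H a' b'
  liftPath [] [] φa' φb' = subst (DPath H _) (φ-inj _ _ (trans φa' (sym φb'))) []
  liftPath (step _ p P) ((d' , refl) ∷ kept) φa' φb' =
    step d' (φ-inj _ _ (trans (src-c d') (trans p (sym φa')))) (liftPath P kept (tgt-c d') φb')

  oneRoot⇔ : ExactlyOneRoot H ⇔ UniqueMark kV nr
  oneRoot⇔ = mk⇔ to from
    where
    to : ExactlyOneRoot H → UniqueMark kV nr
    to (r , r-root , r-unique) =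
      φ r , φ-keep r , trans (sym (root-c r)) r-root ,
      λ y ky y-marked → let (y' , φy') = φ-onto y ky in
        trans (sym φy') (cong φ (r-unique y' (trans (root-c y') (trans (cong nr φy') y-marked))))
    from : UniqueMark kV nr → ExactlyOneRoot H
    from (x , kx , x-marked , x-unique) =
      let (x' , φx') = φ-onto x kx in
      x' , trans (root-c x') (trans (cong nr φx') x-marked) ,
      λ y y-root → φ-inj y x' (trans (x-unique (φ y) (φ-keep y) (trans (sym (root-c y)) y-root)) (sym φx'))

  root-over-mark : ∀ {x} → (∀ y → kV y → nr y ≡ true → y ≡ x) → ∀ r → root H r ≡ true → φ r ≡ x
  root-over-mark x-unique r r-root = x-unique (φ r) (φ-keep r) (trans (sym (root-c r)) r-root)

module Relabelling {G H nl nr} (tr : Trace G H (λ _ → ⊤) (λ _ → ⊤) nl nr) where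
  open Trace tr
  open TraceFacts tr

  pre : Fin (nV G) → Fin (nV H)
  pre x = proj₁ (φ-onto x tt)

  φ-pre : ∀ x → φ (pre x) ≡ x
  φ-pre x = proj₂ (φ-onto x tt)

  all-kept : ∀ ds → All Kept ds
  all-kept = All.universal (λ d → ψ-onto d tt)

  isTree⇒ : IsTree G → IsTree H
  isTree⇒ (nonempty , conn , acG , inG) =
    nonEmpty (pre (someNode nonempty)) , connH , acyclic⇒ acG , atMostOneIncoming⇒ inG
    where
    connH : Connected H
    connH a b = proj₁ (liftWalk (conn (φ a) (φ b)) (all-kept _) refl refl)

  isTree⇐ : IsTree H → IsTree G
  isTree⇐ (nonempty , conn , acH , inH) =
    nonEmpty (φ (someNode nonempty)) , connG , acG , inG
    where
    connG : Connected G
    connG x y = subst₂ (Walk G) (φ-pre x) (φ-pre y) (mapWalk (conn (pre x) (pre y)))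
    acG : Acyclic G
    acG x w = liftCycle acH w (all-kept _) (φ-pre x)
    inG : AtMostOneIncoming G
    inG d d' = incoming-kept inH d d' (ψ-onto d tt) (ψ-onto d' tt)

-- Rules r₀ and r₁: H is G with the leaf v = g(2) and its edge e deleted.
module DeleteLeaf {l₁ G H} (m : Match G l₁ false □ true) (dang : Dangling G (Match.v m) (Match.e m))
  (tr : Trace G H (λ x → x ≢ Match.v m) (λ d → d ≢ Match.e m)
                  (upd (lab G) (Match.u m) □) (upd (root G) (Match.u m) true)) where
  open Match m
  open Trace tr
  open TraceFacts tr

  edge-at-v : ∀ {a b d} → UStep G a b d → a ≡ v ⊎ b ≡ v → d ≡ e
  edge-at-v {a} {b} {d} s at-v with d ≟ e
  ... | yes d≡e = d≡e
  ... | no d≢e with dang d d≢e | s | at-v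
  ...   | src≢v , _ | inj₁ (sa , _) | inj₁ a≡v = ⊥-elim (src≢v (trans sa a≡v))
  ...   | _ , tgt≢v | inj₁ (_ , tb) | inj₂ b≡v = ⊥-elim (tgt≢v (trans tb b≡v))
  ...   | _ , tgt≢v | inj₂ (ta , _) | inj₁ a≡v = ⊥-elim (tgt≢v (trans ta a≡v))
  ...   | src≢v , _ | inj₂ (_ , sb) | inj₂ b≡v = ⊥-elim (src≢v (trans sb b≡v))

  no-edge-from-v : ∀ d → src G d ≢ v
  no-edge-from-v d d-from-v with d ≟ e
  ... | yes refl = u≢v (trans (sym src-e) d-from-v)
  ... | no d≢e = proj₁ (dang d d≢e) d-from-v

  only-edge-into-v : ∀ d → tgt G d ≡ v → d ≡ e
  only-edge-into-v d d-into-v = edge-at-v {d = d} (inj₁ (refl , d-into-v)) (inj₂ refl)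

  kept : ∀ {d} → d ≢ e → Kept d
  kept {d} d≢e = ψ-onto d d≢e

  yu : Fin (nV H)
  yu = proj₁ (φ-onto u u≢v)

  φ-yu : φ yu ≡ u
  φ-yu = proj₂ (φ-onto u u≢v)

  -- Contracting e onto u retracts G onto H.
  ρ : Fin (nV G) → Fin (nV H)
  ρ x with x ≟ v
  ... | yes _ = yu
  ... | no x≢v = proj₁ (φ-onto x x≢v)

  φ-ρ : ∀ x → x ≢ v → φ (ρ x) ≡ x
  φ-ρ x x≢v with x ≟ v
  ... | yes x≡v = ⊥-elim (x≢v x≡v)
  ... | no x≢v' = proj₂ (φ-onto x x≢v')

  ρ-φ : ∀ y → ρ (φ y) ≡ y
  ρ-φ y = φ-inj _ _ (φ-ρ (φ y) (φ-keep y))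

  ρ-ends-of-e : ∀ x → x ≡ u ⊎ x ≡ v → ρ x ≡ yu
  ρ-ends-of-e x (inj₁ refl) = φ-inj _ _ (trans (φ-ρ u u≢v) (sym φ-yu))
  ρ-ends-of-e x (inj₂ refl) with v ≟ v
  ... | yes _ = refl
  ... | no v≢v = ⊥-elim (v≢v refl)

  ends-of-e : ∀ {a b} → UStep G a b e → (a ≡ u ⊎ a ≡ v) × (b ≡ u ⊎ b ≡ v)
  ends-of-e (inj₁ (sa , tb)) = inj₁ (trans (sym sa) src-e) , inj₂ (trans (sym tb) tgt-e)
  ends-of-e (inj₂ (ta , sb)) = inj₂ (trans (sym ta) tgt-e) , inj₁ (trans (sym sb) src-e)

  contractWalk : ∀ {a b} → Walk G a b → Walk H (ρ a) (ρ b)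
  contractWalk [] = []
  contractWalk {a} {b} (_∷_ {y = y} (d , s) w) with d ≟ e
  ... | yes refl =
    let (a-end , y-end) = ends-of-e s in
    subst (λ z → Walk H z (ρ b)) (trans (ρ-ends-of-e y y-end) (sym (ρ-ends-of-e a a-end))) (contractWalk w)
  ... | no d≢e with kept d≢e
  ...   | d' , refl = (d' , contractStep s) ∷ contractWalk w
    where
    contractStep : UStep G a y (ψ d') → UStep H (ρ a) (ρ y) d'
    contractStep (inj₁ (refl , refl)) = inj₁ (sym (trans (cong ρ (sym (src-c d'))) (ρ-φ _)) , sym (trans (cong ρ (sym (tgt-c d'))) (ρ-φ _)))
    contractStep (inj₂ (refl , refl)) = inj₂ (sym (trans (cong ρ (sym (tgt-c d'))) (ρ-φ _)) , sym (trans (cong ρ (sym (src-c d'))) (ρ-φ _)))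

  connected⇒ : Connected G → Connected H
  connected⇒ conn a b = subst₂ (Walk H) (ρ-φ a) (ρ-φ b) (contractWalk (conn (φ a) (φ b)))

  -- Every node of G is joined to u: v by e, the others through H.
  walk-to-u : Connected H → ∀ x → Walk G x u
  walk-to-u conn x with x ≟ v
  ... | yes refl = (e , inj₂ (tgt-e , src-e)) ∷ []
  ... | no x≢v = subst₂ (Walk G) (φ-ρ x x≢v) φ-yu (mapWalk (conn (ρ x) yu))

  connected⇐ : Connected H → Connected G
  connected⇐ conn x y = walk-to-u conn x ++ʷ reverseWalk (walk-to-u conn y)

  leaves-v : ∀ {y b} (w : Walk G y b) → y ≡ v → b ≢ v → e ∈ walkEdges w
  leaves-v [] y≡v b≢v = ⊥-elim (b≢v y≡v)
  leaves-v ((d , s) ∷ w) y≡v _ = here (sym (edge-at-v s (inj₁ y≡v)))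

  enters-v : ∀ {a b} (w : Walk G a b) → a ≢ v → b ≡ v → e ∈ walkEdges w
  enters-v [] a≢v b≡v = ⊥-elim (a≢v b≡v)
  enters-v (_∷_ {y = y} (d , s) w) a≢v b≡v with y ≟ v
  ... | yes y≡v = here (sym (edge-at-v s (inj₂ y≡v)))
  ... | no y≢v = there (enters-v w y≢v b≡v)

  along-e : ∀ {a y} → UStep G a y e → a ≢ v → y ≡ v
  along-e (inj₁ (_ , ty)) _ = trans (sym ty) tgt-e
  along-e (inj₂ (ta , _)) a≢v = ⊥-elim (a≢v (trans (sym ta) tgt-e))

  e-not-loop : ∀ {a y} → UStep G a y e → a ≡ v → y ≢ v
  e-not-loop (inj₁ (sa , _)) a≡v _ = u≢v (trans (sym src-e) (trans sa a≡v))
  e-not-loop (inj₂ (_ , sy)) _ y≡v = u≢v (trans (sym src-e) (trans sy y≡v))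

  avoids-e : ∀ {a b} (w : Walk G a b) → a ≢ v → b ≢ v → Unique (walkEdges w) → All (_≢ e) (walkEdges w)
  avoids-e [] _ _ _ = []
  avoids-e ((d , s) ∷ w) a≢v b≢v (d∉w ∷ uniq) with d ≟ e
  ... | no d≢e = d≢e ∷ avoids-e w (λ y≡v → d≢e (edge-at-v s (inj₂ y≡v))) b≢v uniq
  ... | yes refl = ⊥-elim (All.lookup d∉w (leaves-v w (along-e s a≢v) b≢v) refl)

  -- So a cycle of G avoiding v lifts to H, and a cycle through v would use e twice.
  acyclic⇐ : Acyclic H → Acyclic G
  acyclic⇐ acH x [] ()
  acyclic⇐ acH x w@((d , s) ∷ w') cyc@(d∉w' ∷ _ , _) with x ≟ v
  ... | no x≢v = liftCycle acH w (All.map kept (avoids-e w x≢v x≢v (proj₁ cyc))) (φ-ρ x x≢v) cyc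
  ... | yes refl with edge-at-v s (inj₁ refl)
  ...   | refl = All.lookup d∉w' (enters-v w' (e-not-loop s refl) refl) refl

  atMostOneIncoming⇐ : AtMostOneIncoming H → AtMostOneIncoming G
  atMostOneIncoming⇐ inH d d' eq with tgt G d ≟ v
  ... | yes d-into-v = trans (only-edge-into-v d d-into-v) (sym (only-edge-into-v d' (trans (sym eq) d-into-v)))
  ... | no d↛v = incoming-kept inH d d' (kept λ { refl → d↛v tgt-e }) (kept λ { refl → d↛v (trans eq tgt-e) }) eq

  isTree⇔ : IsTree G ⇔ IsTree H
  isTree⇔ = mk⇔ (λ (_ , conn , acG , inG) → nonEmpty yu , connected⇒ conn , acyclic⇒ acG , atMostOneIncoming⇒ inG)
                (λ (_ , conn , acH , inH) → nonEmpty u , connected⇐ conn , acyclic⇐ acH , atMostOneIncoming⇐ inH)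

  marked-only-u : ExactlyOneRoot G → ∀ y → y ≢ v → upd (root G) u true y ≡ true → y ≡ u
  marked-only-u (r , _ , r-unique) y y≢v y-marked with y ≟ u
  ... | yes y≡u = y≡u
  ... | no _ = ⊥-elim (y≢v (trans (r-unique y y-marked) (sym (r-unique v root-v))))

  root-moves-to-u : ExactlyOneRoot G ⇔ UniqueMark (_≢ v) (upd (root G) u true)
  root-moves-to-u = mk⇔ (λ oneRoot → u , u≢v , upd-here (root G) u true , marked-only-u oneRoot) from
    where
    from : UniqueMark (_≢ v) (upd (root G) u true) → ExactlyOneRoot G
    from (x , _ , _ , x-unique) = v , root-v , only-v
      where
      only-v : ∀ y → root G y ≡ true → y ≡ v
      only-v y y-root with y ≟ v
      ... | yes y≡v = y≡v
      ... | no y≢v with y ≟ u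
      ...   | yes refl = ⊥-elim (true≢false (trans (sym y-root) root-u))
      ...   | no y≢u = ⊥-elim (y≢u (trans (x-unique y y≢v (trans (upd-there (root G) true y≢u) y-root))
                                           (sym (x-unique u u≢v (upd-here (root G) u true)))))

  roots-over-u : ExactlyOneRoot G → ∀ r → root H r ≡ true → φ r ≡ u
  roots-over-u oneRoot = root-over-mark (marked-only-u oneRoot)

  inD⇔ : InD G ⇔ InD H
  inD⇔ = mk⇔ (λ (t , r) → Equivalence.to isTree⇔ t , Equivalence.from oneRoot⇔ (Equivalence.to root-moves-to-u r))
             (λ (t , r) → Equivalence.from isTree⇔ t , Equivalence.from root-moves-to-u (Equivalence.to oneRoot⇔ r))

  stuck-at-v : ∀ {a b} → DPath G a b → a ≡ v → b ≡ v
  stuck-at-v [] a≡v = a≡v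
  stuck-at-v (step d d-from-a _) a≡v = ⊥-elim (no-edge-from-v d (trans d-from-a a≡v))

  path-avoids-e : ∀ {a b} (P : DPath G a b) → b ≢ v → All (_≢ e) (walkEdges (toWalk P))
  path-avoids-e [] _ = []
  path-avoids-e (step d _ P) b≢v = (λ { refl → b≢v (stuck-at-v P tgt-e) }) ∷ path-avoids-e P b≢v

  path-to-u : ∀ {a b} → DPath G a b → b ≡ v → a ≢ v → DPath G a u
  path-to-u [] b≡v a≢v = ⊥-elim (a≢v b≡v)
  path-to-u (step d refl P) b≡v _ with tgt G d ≟ v
  ... | no d↛v = step d refl (path-to-u P b≡v d↛v)
  ... | yes d-into-v with only-edge-into-v d d-into-v
  ...   | refl = subst (DPath G (src G e)) src-e []

-- Rule r₂: H is G with the root moved from u along e to v, u becoming △.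
module MoveRoot {G H} (m : Match G □ true □ false)
  (tr : Trace G H (λ _ → ⊤) (λ _ → ⊤) (upd (upd (lab G) (Match.u m) △) (Match.v m) □)
                                        (upd (upd (root G) (Match.u m) false) (Match.v m) true)) where
  open Match m
  open Trace tr
  open TraceFacts tr using (oneRoot⇔; root-over-mark)
  open Relabelling tr using (isTree⇒; isTree⇐)

  marked-only-v : ExactlyOneRoot G → ∀ y → ⊤ → upd (upd (root G) u false) v true y ≡ true → y ≡ v
  marked-only-v (r , _ , r-unique) y _ y-marked with y ≟ v
  ... | yes y≡v = y≡v
  ... | no y≢v with y ≟ u   -- the case splits evaluate the updates in y-marked
  ...   | yes refl = ⊥-elim (true≢false (sym y-marked))
  ...   | no y≢u = ⊥-elim (y≢u (trans (r-unique y y-marked) (sym (r-unique u root-u))))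

  root-moves-to-v : ExactlyOneRoot G ⇔ UniqueMark (λ _ → ⊤) (upd (upd (root G) u false) v true)
  root-moves-to-v = mk⇔ (λ oneRoot → v , tt , upd-here (upd (root G) u false) v true , marked-only-v oneRoot) from
    where
    from : UniqueMark (λ _ → ⊤) (upd (upd (root G) u false) v true) → ExactlyOneRoot G
    from (x , _ , _ , x-unique) = u , root-u , only-u
      where
      only-u : ∀ y → root G y ≡ true → y ≡ u
      only-u y y-root with y ≟ u
      ... | yes y≡u = y≡u
      ... | no y≢u with y ≟ v
      ...   | yes refl = ⊥-elim (true≢false (trans (sym y-root) root-v))
      ...   | no y≢v = ⊥-elim (y≢v (trans (x-unique y tt (trans (upd₂-there (root G) false true y≢u y≢v) y-root))
                                           (sym (x-unique v tt (upd-here (upd (root G) u false) v true)))))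

  roots-over-v : ExactlyOneRoot G → ∀ r → root H r ≡ true → φ r ≡ v
  roots-over-v oneRoot = root-over-mark (marked-only-v oneRoot)

  inD⇔ : InD G ⇔ InD H
  inD⇔ = mk⇔ (λ (t , r) → isTree⇒ t , Equivalence.from oneRoot⇔ (Equivalence.to root-moves-to-v r))
             (λ (t , r) → isTree⇐ t , Equivalence.from root-moves-to-v (Equivalence.to oneRoot⇔ r))

garbage-separating : GarbageSeparating
garbage-separating G H (inj₁ (m , dang , tr)) = DeleteLeaf.inD⇔ m dang tr
garbage-separating G H (inj₂ (inj₁ (m , dang , tr))) = DeleteLeaf.inD⇔ m dang tr
garbage-separating G H (inj₂ (inj₂ (m , tr))) = MoveRoot.inD⇔ m tr

record Invariant (G : TLRG) : Set where
  field
    inD     : InD G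
    root-□  : ∀ r → root G r ≡ true → lab G r ≡ □
    △-above : ∀ w → lab G w ≡ △ → ∀ r → root G r ≡ true → DPath G w r

  oneRoot : ExactlyOneRoot G
  oneRoot = proj₂ inD

  connected : Connected G
  connected = proj₁ (proj₂ (proj₁ inD))

  acyclic : Acyclic G
  acyclic = proj₁ (proj₂ (proj₂ (proj₁ inD)))

  atMostOneIncoming : AtMostOneIncoming G
  atMostOneIncoming = proj₂ (proj₂ (proj₂ (proj₁ inD)))

-- Graphs in E satisfy it vacuously: they have no △-nodes.
invariant-E : ∀ {G} → InE G → Invariant G
invariant-E (inD , all-□ , _) = record
  { inD = inD
  ; root-□ = λ r _ → all-□ r
  ; △-above = λ w w-△ → ⊥-elim (□≢△ (trans (sym (all-□ w)) w-△)) }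

-- Isomorphisms keep the invariant: paths lift along them.
invariant-iso : ∀ {G H} → G ≅ H → Invariant G → Invariant H
invariant-iso {G} {H} tr record { inD = (tree , r , r-root , r-unique) ; root-□ = root-□ ; △-above = △-above } =
  record
  { inD = isTree⇒ tree , Equivalence.from oneRoot⇔ (r , tt , r-root , λ y _ → r-unique y)
  ; root-□ = λ y y-root → trans (lab-c y) (root-□ (φ y) (over-root y y-root))
  ; △-above = λ w w-△ y y-root →
      liftPath (△-above (φ w) (trans (sym (lab-c w)) w-△) (φ y) (over-root y y-root)) (all-kept _) refl refl }
  where
  open Trace tr
  open TraceFacts tr
  open Relabelling tr
  over-root : ∀ y → root H y ≡ true → root G (φ y) ≡ true
  over-root y y-root = trans (sym (root-c y)) y-root

-- Rule r₂ keeps the invariant: the new △-node u lies above the new root v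
-- via e, and so do the old △-nodes via their paths to u.
invariant-r2 : ∀ {G H} → Apply-r2 G H → Invariant G → Invariant H
invariant-r2 {G} {H} (m , tr) record { inD = inD ; root-□ = _ ; △-above = △-above } = record
  { inD = Equivalence.to inD⇔ inD
  ; root-□ = λ r r-root → trans (lab-c r) (trans (cong L (roots-over-v (proj₂ inD) r r-root)) (upd-here (upd (lab G) u △) v □))
  ; △-above = λ w w-△ r r-root →
      liftPath (snoc (path-to-u (φ w) (trans (sym (lab-c w)) w-△)) e src-e) (all-kept _) refl
               (trans (roots-over-v (proj₂ inD) r r-root) (sym tgt-e)) }
  where
  open Match m
  open Trace tr
  open TraceFacts tr using (liftPath)
  open Relabelling tr using (all-kept)
  open MoveRoot m tr using (inD⇔; roots-over-v)
  L : Fin (nV G) → NLabel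
  L = upd (upd (lab G) u △) v □
  path-to-u : ∀ x → L x ≡ △ → DPath G x u
  path-to-u x x-△ with x ≟ v
  ... | yes refl = ⊥-elim (□≢△ x-△)
  ... | no x≢v with x ≟ u
  ...   | yes refl = []
  ...   | no x≢u = △-above x x-△ u root-u

-- Rules r₀, r₁ keep the invariant: the new root u is labelled □, and a path
-- from a △-node to the deleted root v is cut at u.
invariant-r01 : ∀ {l₁ G H} → Apply-r01 l₁ G H → Invariant G → Invariant H
invariant-r01 {G = G} {H} (m , dang , tr) record { inD = inD ; root-□ = root-□ ; △-above = △-above } = record
  { inD = Equivalence.to inD⇔ inD
  ; root-□ = λ r r-root → trans (lab-c r) (trans (cong (upd (lab G) u □) (roots-over-u (proj₂ inD) r r-root)) (upd-here (lab G) u □))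
  ; △-above = λ w w-△ r r-root →
      let P = path-to-u (△-above-v (φ w) (trans (sym (lab-c w)) w-△)) refl (φ-keep w) in
      liftPath P (All.map kept (path-avoids-e P u≢v)) refl (roots-over-u (proj₂ inD) r r-root) }
  where
  open Match m
  open Trace tr
  open TraceFacts tr using (liftPath)
  open DeleteLeaf m dang tr using (inD⇔; roots-over-u; kept; path-to-u; path-avoids-e)
  △-above-v : ∀ x → upd (lab G) u □ x ≡ △ → DPath G x v
  △-above-v x x-△ with x ≟ u
  ... | yes refl = ⊥-elim (□≢△ x-△)
  ... | no _ = △-above x x-△ v root-v

invariant-step : ∀ {G H} → G ≅ H ⊎ G ⇒ H → Invariant G → Invariant H
invariant-step (inj₁ iso) = invariant-iso iso
invariant-step (inj₂ (inj₁ r₀-step)) = invariant-r01 r₀-step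
invariant-step (inj₂ (inj₂ (inj₁ r₁-step))) = invariant-r01 r₁-step
invariant-step (inj₂ (inj₂ (inj₂ r₂-step))) = invariant-r2 r₂-step

invariant-star : ∀ {G H} → G ⇒* H → Invariant G → Invariant H
invariant-star ε inv = inv
invariant-star (s ◅ ss) inv = invariant-star ss (invariant-step s inv)

-- The graph with one node, labelled □ and rooted, and no edges: the common
-- reduct of all derivations from E.
Singleton : TLRG
Singleton = record { nV = 1 ; nE = 0 ; src = λ () ; tgt = λ () ; lab = λ _ → □ ; elab = λ () ; root = λ _ → true }

isolated-root : ∀ (H : TLRG) r → lab H r ≡ □ → root H r ≡ true → Connected H →
                (∀ d → src H d ≢ r) → (∀ d → tgt H d ≢ r) → H ≅ Singleton
isolated-root H r r-□ r-root conn no-out no-in = record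
  { φ = λ _ → r ; φ-inj = λ { zero zero _ → refl } ; φ-keep = λ _ → tt
  ; φ-onto = λ x _ → zero , sym (only-r x)
  ; ψ = λ () ; ψ-inj = λ () ; ψ-keep = λ () ; ψ-onto = λ d _ → ⊥-elim (no-out d (only-r (src H d)))
  ; src-c = λ () ; tgt-c = λ () ; elab-c = λ ()
  ; lab-c = λ _ → sym r-□ ; root-c = λ _ → sym r-root }
  where
  stays-at-r : ∀ {a b} → Walk H a b → a ≡ r → b ≡ r
  stays-at-r [] a≡r = a≡r
  stays-at-r ((d , inj₁ (d-from-a , _)) ∷ _) a≡r = ⊥-elim (no-out d (trans d-from-a a≡r))
  stays-at-r ((d , inj₂ (d-into-a , _)) ∷ _) a≡r = ⊥-elim (no-in d (trans d-into-a a≡r))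
  only-r : ∀ x → x ≡ r
  only-r x = stays-at-r (conn r x) refl

relabel : (H : TLRG) → (Fin (nV H) → NLabel) → (Fin (nV H) → Bool) → TLRG
relabel H L R = record H { lab = L ; root = R }

relabel-trace : (H : TLRG) (L : Fin (nV H) → NLabel) (R : Fin (nV H) → Bool) →
                Trace H (relabel H L R) (λ _ → ⊤) (λ _ → ⊤) L R
relabel-trace H L R = record
  { φ = λ x → x ; φ-inj = λ _ _ eq → eq ; φ-keep = λ _ → tt ; φ-onto = λ x _ → x , refl
  ; ψ = λ d → d ; ψ-inj = λ _ _ eq → eq ; ψ-keep = λ _ → tt ; ψ-onto = λ d _ → d , refl
  ; src-c = λ _ → refl ; tgt-c = λ _ → refl ; elab-c = λ _ → refl
  ; lab-c = λ _ → refl ; root-c = λ _ → refl }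

-- Deleting a node v and an edge e such that no other edge touches v, and
-- relabelling the remaining nodes; nodes and edges are renumbered by punchIn.
deleteNode : (H : TLRG) (v : Fin (nV H)) (e : Fin (nE H)) → Dangling H v e →
             (L : Fin (nV H) → NLabel) (R : Fin (nV H) → Bool) →
             Σ TLRG λ H' → suc (nV H') ≡ nV H × Trace H H' (_≢ v) (_≢ e) L R
deleteNode record { nV = suc n ; nE = suc k ; src = s ; tgt = t ; lab = _ ; elab = el ; root = _ } v e dang L R =
  H' , refl , trace
  where
  src' : Fin k → Fin n
  src' d = punchOut {i = v} {j = s (punchIn e d)} (λ eq → proj₁ (dang (punchIn e d) (FinP.punchInᵢ≢i e d)) (sym eq))
  tgt' : Fin k → Fin n
  tgt' d = punchOut {i = v} {j = t (punchIn e d)} (λ eq → proj₂ (dang (punchIn e d) (FinP.punchInᵢ≢i e d)) (sym eq))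
  H' : TLRG
  H' = record { nV = n ; nE = k ; src = src' ; tgt = tgt' ; lab = λ x → L (punchIn v x)
              ; elab = λ d → el (punchIn e d) ; root = λ x → R (punchIn v x) }
  trace : Trace _ H' (_≢ v) (_≢ e) L R
  trace = record
    { φ = punchIn v ; φ-inj = FinP.punchIn-injective v ; φ-keep = FinP.punchInᵢ≢i v
    ; φ-onto = λ x x≢v → punchOut (λ eq → x≢v (sym eq)) , FinP.punchIn-punchOut _
    ; ψ = punchIn e ; ψ-inj = FinP.punchIn-injective e ; ψ-keep = FinP.punchInᵢ≢i e
    ; ψ-onto = λ d d≢e → punchOut (λ eq → d≢e (sym eq)) , FinP.punchIn-punchOut _
    ; src-c = λ _ → FinP.punchIn-punchOut _ ; tgt-c = λ _ → FinP.punchIn-punchOut _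
    ; elab-c = λ _ → refl ; lab-c = λ _ → refl ; root-c = λ _ → refl }

elab-□ : ∀ (H : TLRG) d → elab H d ≡ e□
elab-□ H d with elab H d
... | e□ = refl

unrooted : ∀ {H : TLRG} → ExactlyOneRoot H → ∀ {r} → root H r ≡ true → ∀ {x} → x ≢ r → root H x ≡ false
unrooted {H} (_ , _ , unique) r-root {x} x≢r with root H x in x-root
... | true = ⊥-elim (x≢r (trans (unique x x-root) (sym (unique _ r-root))))
... | false = refl

-- If the root r has an outgoing edge d, then r₂ applies along d and moves the
-- root to its target c: c is neither r (no loops) nor a △-node (that would
-- close a directed cycle through r).
pushRoot : ∀ {H} → Invariant H → ∀ {r} → root H r ≡ true → ∀ d → src H d ≡ r →
           H ⇒ relabel H (upd (upd (lab H) r △) (tgt H d) □) (upd (upd (root H) r false) (tgt H d) true)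
pushRoot {H} inv {r} r-root d d-from-r = inj₂ (inj₂ (match , relabel-trace H _ _))
  where
  open Invariant inv
  open AcyclicGraph acyclic
  c : Fin (nV H)
  c = tgt H d
  c≢r : c ≢ r
  c≢r c≡r = no-closed-path (step d d-from-r (subst (DPath H c) c≡r [])) (s≤s z≤n)
  c-□ : lab H c ≡ □
  c-□ with lab H c in c-lab
  ... | □ = refl
  ... | △ = ⊥-elim (no-closed-path (step d d-from-r (△-above c c-lab r r-root)) (s≤s z≤n))
  match : Match H □ true □ false
  match = record { u = r ; v = c ; e = d ; u≢v = λ r≡c → c≢r (sym r≡c) ; src-e = d-from-r ; tgt-e = refl
                 ; elab-e = elab-□ H d ; lab-u = root-□ r r-root ; root-u = r-root ; lab-v = c-□
                 ; root-v = unrooted {H} oneRoot r-root c≢r }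

r01-step : ∀ {G H} l₁ → Apply-r01 l₁ G H → G ⇒ H
r01-step □ application = inj₁ application
r01-step △ application = inj₂ (inj₁ application)

removeRoot : ∀ {H} → Invariant H → ∀ {r} → root H r ≡ true → (∀ d → src H d ≢ r) → ∀ e → tgt H e ≡ r →
             Σ TLRG λ H' → suc (nV H') ≡ nV H × H ⇒ H'
removeRoot {H} inv {r} r-root no-out e e-into-r =
  let (H' , smaller , trace) = deleteNode H r e dangling (upd (lab H) u □) (upd (root H) u true)
  in H' , smaller , r01-step (lab H u) (match , dangling , trace)
  where
  open Invariant inv
  u : Fin (nV H)
  u = src H e
  dangling : Dangling H r e
  dangling d d≢e = no-out d , λ d-into-r → d≢e (atMostOneIncoming d e (trans d-into-r (sym e-into-r)))
  match : Match H (lab H u) false □ true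
  match = record { u = u ; v = r ; e = e ; u≢v = no-out e ; src-e = refl ; tgt-e = e-into-r
                 ; elab-e = elab-□ H e ; lab-u = refl ; root-u = unrooted {H} oneRoot r-root (no-out e)
                 ; lab-v = root-□ r r-root ; root-v = r-root }

-- While the
-- root has an outgoing edge it is pushed down by r₂, which only relabels;
-- then it is deleted through its incoming edge by r₀/r₁, or it is isolated.
-- Pushing extends a directed path ending at the root, whose length is bounded
-- by the number of nodes, and deleting decreases the number of nodes.
collapse : ∀ n (H : TLRG) → nV H ≡ n → Invariant H → H ⇒* Singleton
collapse zero H size record { inD = ((nonempty , _) , _) } = ⊥-elim (ℕP.<-irrefl (sym size) nonempty)
collapse (suc n) H size inv@record { inD = (_ , _ , root-rooted , _) } =
  descend (suc n) (lab H) (root H) inv root-rooted [] ℕP.≤-refl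
  where
  open ℕP.≤-Reasoning
  open AcyclicGraph (Invariant.acyclic inv)
  descend : ∀ k L R → Invariant (relabel H L R) → ∀ {a r} → R r ≡ true → (Q : DPath H a r) →
            suc n ≤ plen Q + k → relabel H L R ⇒* Singleton
  descend k L R inv' {r = r} r-root Q bound with FinP.any? (λ d → src H d ≟ r)
  ... | yes (d , d-from-r) with k
  ...   | zero = ⊥-elim (ℕP.<-irrefl refl (begin-strict
            plen Q                       <⟨ ℕP.n<1+n (plen Q) ⟩
            suc (plen Q)                 ≡⟨ plen-snoc Q d d-from-r ⟨
            plen (snoc Q d d-from-r)     ≤⟨ plen-bound (snoc Q d d-from-r) ⟩
            nV H                         ≡⟨ size ⟩
            suc n                        ≤⟨ bound ⟩
            plen Q + 0                   ≡⟨ ℕP.+-identityʳ (plen Q) ⟩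
            plen Q                       ∎))
  ...   | suc k' =
    let push = pushRoot inv' r-root d d-from-r in
    inj₂ push ◅ descend k' _ _ (invariant-step (inj₂ push) inv') (upd-here (upd R r false) (tgt H d) true)
                        (snoc Q d d-from-r)
                        (subst (suc n ≤_) (trans (ℕP.+-suc (plen Q) k') (cong (_+ k') (sym (plen-snoc Q d d-from-r)))) bound)
  descend k L R inv' {r = r} r-root Q bound | no no-out with FinP.any? (λ e → tgt H e ≟ r)
  ... | yes (e , e-into-r) =
    let (H' , smaller , delete) = removeRoot inv' r-root (λ d d-from-r → no-out (d , d-from-r)) e e-into-r in
    inj₂ delete ◅ collapse n H' (ℕP.suc-injective (trans smaller size)) (invariant-step (inj₂ delete) inv')
  ... | no no-in =
    inj₁ (isolated-root (relabel H L R) r (Invariant.root-□ inv' r r-root) r-root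
                        (Invariant.connected inv')
                        (λ d d-from-r → no-out (d , d-from-r)) (λ d d-into-r → no-in (d , d-into-r))) ◅ ε

confluent-modulo-garbage : ConfluentModuloGarbage
confluent-modulo-garbage G inE H₁ H₂ G⇒*H₁ G⇒*H₂ =
  Singleton , to-singleton G⇒*H₁ , to-singleton G⇒*H₂
  where
  to-singleton : ∀ {H} → G ⇒* H → H ⇒* Singleton
  to-singleton {H} G⇒*H = collapse (nV H) H refl (invariant-star G⇒*H (invariant-E inE))

mainTheorem12 : GarbageSeparating × ConfluentModuloGarbage
mainTheorem12 = garbage-separating , confluent-modulo-garbage
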